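{- Work in $\mathbf{MLTT_0}$. For every small type $A$, family $I(x)\in\mathsf{U_0}\ [x\in A]$ and family $C(x,y)\in A\to\mathsf{U_0}\ [x\in A,y\in I(x)]$, the endofunctor $\mathsf{Conf}_{I,C}$ is isomorphic to an endofunctor of the form $\mathsf{Der}_{Br,ar}$ for some indexed container $(A,I',Br,ar)$.
   Context: $\mathbf{MLTT_0}$ is intensional Martin-Löf type theory with $\mathsf{N_0}$, $\mathsf{N_1}$, $\Sigma$, $\Pi$, $\mathsf{List}$, identity types, binary sums $+$, and a universe $\mathsf{U_0}$ à la Russell closed under these, with $\eta$-equalities for $\mathsf{N_1}$, $\Sigma$ and $\Pi$. An indexed container consists of $A\in\mathsf{U_0}$, $I'(x)\in\mathsf{U_0}\ [x\in A]$, $Br(x,y)\in\mathsf{U_0}\ [x\in A,y\in I'(x)]$ and $ar(x,y)\in Br(x,y)\to A$. For an $A$-indexed family of types $P(x)\ [x\in A]$ define $\mathsf{Conf}_{I,C}(P)(x):\equiv(\Pi y\in I(x))(\Sigma z\in A)(C(x,y,z)\times P(z))$ and $\mathsf{Der}_{Br,ar}(P)(x):\equiv(\Sigma y\in I'(x))(\Pi z\in Br(x,y))P(ar(x,y,z))$, acting on families of functions in the evident way. Two such endofunctors are isomorphic if, for every family $P$ and $x\in A$, there are mutually inverse (up to propositional equality) maps between their values at $P$ and $x$, natural in $P$. -}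

module Defs where

open import Level using (Level; Setω)
open import Data.Product using (Σ; _×_; _,_; proj₁; proj₂)
open import Relation.Binary.PropositionalEquality using (_≡_)

Conf : {ℓ : Level} {A : Set} (I : A → Set) (C : (x : A) → I x → A → Set)
       (P : A → Set ℓ) → A → Set ℓ
Conf {A = A} I C P x = (y : I x) → Σ A (λ z → C x y z × P z)

Conf-map : {ℓ ℓ' : Level} {A : Set} (I : A → Set) (C : (x : A) → I x → A → Set)
           {P : A → Set ℓ} {Q : A → Set ℓ'} → ((z : A) → P z → Q z) →
           (x : A) → Conf I C P x → Conf I C Q x
Conf-map I C f x c y = proj₁ (c y) , proj₁ (proj₂ (c y)) , f (proj₁ (c y)) (proj₂ (proj₂ (c y)))

Der : {ℓ : Level} {A : Set} {I' : A → Set} (Br : (x : A) → I' x → Set)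
      (ar : (x : A) (y : I' x) → Br x y → A) (P : A → Set ℓ) → A → Set ℓ
Der {I' = I'} Br ar P x = Σ (I' x) (λ y → (z : Br x y) → P (ar x y z))

Der-map : {ℓ ℓ' : Level} {A : Set} {I' : A → Set} (Br : (x : A) → I' x → Set)
          (ar : (x : A) (y : I' x) → Br x y → A)
          {P : A → Set ℓ} {Q : A → Set ℓ'} → ((z : A) → P z → Q z) →
          (x : A) → Der Br ar P x → Der Br ar Q x
Der-map Br ar f x (y , g) = y , λ z → f (ar x y z) (g z)

record ConfIsoDer (A : Set) (I : A → Set) (C : (x : A) → I x → A → Set) : Setω where
  field
    I'  : A → Set
    Br  : (x : A) → I' x → Set
    ar  : (x : A) (y : I' x) → Br x y → A
    to   : {ℓ : Level} (P : A → Set ℓ) (x : A) → Conf I C P x → Der Br ar P x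
    from : {ℓ : Level} (P : A → Set ℓ) (x : A) → Der Br ar P x → Conf I C P x
    from-to : {ℓ : Level} (P : A → Set ℓ) (x : A) (c : Conf I C P x) →
              from P x (to P x c) ≡ c
    to-from : {ℓ : Level} (P : A → Set ℓ) (x : A) (d : Der Br ar P x) →
              to P x (from P x d) ≡ d
    to-natural : {ℓ ℓ' : Level} (P : A → Set ℓ) (Q : A → Set ℓ')
                 (f : (z : A) → P z → Q z) (x : A) (c : Conf I C P x) →
                 to Q x (Conf-map I C f x c) ≡ Der-map Br ar f x (to P x c)
    from-natural : {ℓ ℓ' : Level} (P : A → Set ℓ) (Q : A → Set ℓ')
                   (f : (z : A) → P z → Q z) (x : A) (d : Der Br ar P x) →
                   from Q x (Der-map Br ar f x d) ≡ Conf-map I C f x (from P x d)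

{-# OPTIONS --safe #-}

-- Conf_{I,C}(P)(x) is a Π of Σs. After reassociating each Σ so that the
-- C-component sits next to the point z it constrains, the type-theoretic
-- axiom of choice (Π distributes over Σ) turns it into a Σ of Πs, which is the
-- extension of the container with shapes (Π y ∈ I(x)) (Σ z ∈ A) C(x,y,z) and
-- positions I(x), a position y pointing to the z chosen for it.
module Submission where

open import Level using (Level)
open import Data.Product using (Σ; _,_; proj₁; proj₂; assocʳ; assocˡ)
open import Relation.Binary.PropositionalEquality using (refl)

open import Defs

private
  variable
    a b ℓ : Level

module _ {X : Set a} {B : X → Set b} {R : (x : X) → B x → Set ℓ} where

  ΠΣ⇒ΣΠ : ((x : X) → Σ (B x) (R x)) → Σ ((x : X) → B x) (λ f → (x : X) → R x (f x))
  ΠΣ⇒ΣΠ g = (λ x → proj₁ (g x)) , (λ x → proj₂ (g x))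

  ΣΠ⇒ΠΣ : Σ ((x : X) → B x) (λ f → (x : X) → R x (f x)) → (x : X) → Σ (B x) (R x)
  ΣΠ⇒ΠΣ (f , r) x = f x , r x

module _ {A : Set} (I : A → Set) (C : (x : A) → I x → A → Set) where

  Shape : A → Set
  Shape x = (y : I x) → Σ A (C x y)

  Position : (x : A) → Shape x → Set
  Position x _ = I x

  target : (x : A) (s : Shape x) → Position x s → A
  target x s y = proj₁ (s y)

  Conf⇒Der : (P : A → Set ℓ) (x : A) → Conf I C P x → Der Position target P x
  Conf⇒Der P x c = ΠΣ⇒ΣΠ (λ y → assocˡ (c y))

  Der⇒Conf : (P : A → Set ℓ) (x : A) → Der Position target P x → Conf I C P x
  Der⇒Conf P x d y = assocʳ (ΣΠ⇒ΠΣ d y)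

-- The inverse and naturality laws all hold definitionally, by η for Σ and Π.
proposition4p1 : (A : Set) (I : A → Set) (C : (x : A) → I x → A → Set) →
    ConfIsoDer A I C
proposition4p1 A I C = record
  { I'           = Shape I C
  ; Br           = Position I C
  ; ar           = target I C
  ; to           = Conf⇒Der I C
  ; from         = Der⇒Conf I C
  ; from-to      = λ _ _ _ → refl
  ; to-from      = λ _ _ _ → refl
  ; to-natural   = λ _ _ _ _ _ → refl
  ; from-natural = λ _ _ _ _ _ → refl
  }
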